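{- Let $G$ be a simple graph on $n$ vertices such that $G$ and its complement $\overline{G}$ are both connected and $rc(G)=rc(\overline{G})=2$. Then: (1) $\mathrm{diam}(G)=\mathrm{diam}(\overline{G})=2$; (2) $2\leq \delta(G)\leq\Delta(G)\leq n-3$ and $2\leq\delta(\overline{G})\leq\Delta(\overline{G})\leq n-3$; (3) for every vertex $v$ of $G$, no vertex $u\in N_1(v)$ is adjacent (in $G$) to all vertices of $N_2(v)$.
   Context: All graphs are simple, finite and undirected. For a connected graph $G$, an edge coloring $c:E(G)\to\{1,\dots,k\}$ (adjacent edges may receive the same color) makes $G$ rainbow connected if for every two vertices $u,v$ there is a $u$–$v$ path whose edges have pairwise distinct colors; $rc(G)$ is the minimum such $k$. $\mathrm{diam}$ is the diameter, $\delta,\Delta$ the minimum and maximum degree. For a vertex $v$, $N_1(v)$ is the set of vertices at distance exactly $1$ from $v$ and $N_2(v)$ the set of vertices at distance exactly $2$ from $v$ in $G$. -}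

module Defs where

open import Data.Nat using (ℕ; zero; suc; _+_; _≤_; _<_; _∸_)
open import Data.Fin using (Fin; _≟_)
open import Data.Bool using (Bool; true; false; not; if_then_else_)
open import Data.List using (List; []; _∷_; map; allFin)
open import Data.Nat.ListAction using (sum)
open import Data.List.Relation.Unary.Unique.Propositional using (Unique)
open import Data.Product using (Σ; ∃; ∃-syntax; _×_; _,_)
open import Relation.Nullary using (¬_; does)
open import Relation.Binary.PropositionalEquality using (_≡_)

Graph : ℕ → Set
Graph n = Fin n → Fin n → Bool

IsSimple : ∀ {n} → Graph n → Set
IsSimple {n} g = (∀ (u v : Fin n) → g u v ≡ g v u) × (∀ (v : Fin n) → g v v ≡ false)

complement : ∀ {n} → Graph n → Graph n
complement g u v = if does (u ≟ v) then false else not (g u v)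

data Walk {n} (g : Graph n) : Fin n → Fin n → Set where
  [] : ∀ {u} → Walk g u u
  _∷_ : ∀ {u v w} → g u v ≡ true → Walk g v w → Walk g u w

len : ∀ {n} {g : Graph n} {u v} → Walk g u v → ℕ
len [] = 0
len (_ ∷ p) = suc (len p)

vertices : ∀ {n} {g : Graph n} {u v} → Walk g u v → List (Fin n)
vertices {u = u} [] = u ∷ []
vertices (_∷_ {u} _ p) = u ∷ vertices p

IsPath : ∀ {n} {g : Graph n} {u v} → Walk g u v → Set
IsPath p = Unique (vertices p)

-- Edge colorings with colors Fin k (colors 1..k); symmetric so that they
-- are colorings of undirected edges.  Adjacent edges may share colors.
Coloring : ℕ → ℕ → Set
Coloring n k = Fin n → Fin n → Fin k

IsEdgeColoring : ∀ {n k} → Coloring n k → Set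
IsEdgeColoring {n} c = ∀ (u v : Fin n) → c u v ≡ c v u

edgeColors : ∀ {n k} {g : Graph n} {u v} → Coloring n k → Walk g u v → List (Fin k)
edgeColors c [] = []
edgeColors c (_∷_ {u} {v} _ p) = c u v ∷ edgeColors c p

Rainbow : ∀ {n k} {g : Graph n} {u v} → Coloring n k → Walk g u v → Set
Rainbow c p = Unique (edgeColors c p)

RainbowConnecting : ∀ {n k} → Graph n → Coloring n k → Set
RainbowConnecting {n} g c =
  ∀ (u v : Fin n) → Σ (Walk g u v) (λ p → IsPath p × Rainbow c p)

RainbowColorable : ∀ {n} → Graph n → ℕ → Set
RainbowColorable {n} g k =
  Σ (Coloring n k) (λ c → IsEdgeColoring c × RainbowConnecting g c)

RC : ∀ {n} → Graph n → ℕ → Set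
RC g k = RainbowColorable g k × (∀ j → j < k → ¬ RainbowColorable g j)

Connected : ∀ {n} → Graph n → Set
Connected {n} g = ∀ (u v : Fin n) → Walk g u v

Dist : ∀ {n} → Graph n → Fin n → Fin n → ℕ → Set
Dist g u v d = Σ (Walk g u v) (λ p → len p ≡ d) × (∀ (q : Walk g u v) → d ≤ len q)

Diam : ∀ {n} → Graph n → ℕ → Set
Diam {n} g d =
  (∀ (u v : Fin n) → ∃[ e ] (Dist g u v e × e ≤ d)) × (∃[ u ] ∃[ v ] Dist g u v d)

deg : ∀ {n} → Graph n → Fin n → ℕ
deg {n} g v = sum (map (λ w → if g v w then 1 else 0) (allFin n))

MinDeg : ∀ {n} → Graph n → ℕ → Set
MinDeg {n} g d = (∃[ v ] deg g v ≡ d) × (∀ (v : Fin n) → d ≤ deg g v)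

MaxDeg : ∀ {n} → Graph n → ℕ → Set
MaxDeg {n} g d = (∃[ v ] deg g v ≡ d) × (∀ (v : Fin n) → deg g v ≤ d)

InN1 : ∀ {n} → Graph n → Fin n → Fin n → Set
InN1 g v u = Dist g v u 1

InN2 : ∀ {n} → Graph n → Fin n → Fin n → Set
InN2 g v u = Dist g v u 2

module Submission where

-- With only two colours a rainbow path has at most two edges, so rc(h) ≤ 2 puts
-- every two vertices of h within distance two (withinTwo); rc(h) ≠ 1 means h is
-- not complete, because the one-colour colouring of a complete graph is rainbow
-- connecting (missingEdge).  Together: diam(h) = 2 (diameterTwo).
-- If two edge-disjoint graphs on the same vertex set both have all pairs within
-- distance two, every vertex has two neighbours in each of them (module
-- TwoNeighbours); so δ ≥ 2 in G and in Ḡ.  Counting gives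
-- deg_G v + deg_Ḡ v = n - 1 (degreeSum), so Δ(G) ≤ n - 1 - δ(Ḡ) ≤ n - 3 and
-- symmetrically (degreeBounds).  For (3), take u ∈ N₁(v): the Ḡ-path of length
-- two from u to v passes through a vertex x that is non-adjacent in G to both v
-- and u; then x ∈ N₂(v) (notAdjacentToAllOfN₂).

open import Defs
open import Data.Nat using (ℕ; _≤_; _∸_)
open import Data.Fin using (Fin)
open import Data.Bool using (true)
open import Data.Product using (_×_; ∃-syntax)
open import Relation.Nullary using (¬_)
open import Relation.Binary.PropositionalEquality using (_≡_)

open import Data.Nat using (zero; suc; _+_; z≤n; s≤s)
open import Data.Nat.Properties
  using (≤-refl; ≤-trans; +-comm; +-monoʳ-≤; m≤m+n; m≤n+m; m+n≤o⇒m≤o∸n; ∸-+-assoc; +-commutativeSemigroup)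
open import Algebra.Properties.CommutativeSemigroup +-commutativeSemigroup using (interchange)
open import Data.Fin using (_≟_) renaming (zero to fzero; suc to fsuc)
open import Data.Fin.Properties using (any?)
open import Data.Bool using (Bool; false; if_then_else_; not)
open import Data.Bool.Properties using () renaming (_≟_ to _≟ᵇ_)
open import Data.List using (tabulate; allFin)
open import Data.List.Properties using (map-tabulate; tabulate-cong)
open import Data.List.Extrema.Nat using (argmin; argmax; f[argmin]≤f[xs]; f[xs]≤f[argmax])
open import Data.List.Membership.Propositional.Properties using (∈-allFin)
open import Data.List.Relation.Unary.All using ([]; _∷_; lookup)
open import Data.List.Relation.Unary.AllPairs using ([]; _∷_)
open import Data.Nat.ListAction using (sum)
open import Data.Product using (∃; _,_; proj₁)
open import Data.Empty using (⊥; ⊥-elim)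
open import Function using (id)
open import Relation.Nullary using (yes; no; does; ¬?)
open import Relation.Nullary.Decidable using (_×-dec_)
open import Relation.Binary.PropositionalEquality
  using (refl; sym; trans; cong; cong₂; subst; subst₂; module ≡-Reasoning)

private
  variable
    n : ℕ

notBoth : {b : Bool} → b ≡ true → b ≡ false → ⊥
notBoth refl ()

data WithinTwo (h : Graph n) (u v : Fin n) : Set where
  same     : u ≡ v → WithinTwo h u v
  adjacent : h u v ≡ true → WithinTwo h u v
  via      : ∀ x → h u x ≡ true → h x v ≡ true → WithinTwo h u v

noThreeColours : (a b c : Fin 2) → ¬ a ≡ b → ¬ a ≡ c → ¬ b ≡ c → ⊥
noThreeColours fzero fzero _ a≢b _ _ = a≢b refl
noThreeColours fzero (fsuc fzero) fzero _ a≢c _ = a≢c refl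
noThreeColours fzero (fsuc fzero) (fsuc fzero) _ _ b≢c = b≢c refl
noThreeColours (fsuc fzero) fzero fzero _ _ b≢c = b≢c refl
noThreeColours (fsuc fzero) fzero (fsuc fzero) _ a≢c _ = a≢c refl
noThreeColours (fsuc fzero) (fsuc fzero) _ a≢b _ _ = a≢b refl

-- rc(h) ≤ 2 implies every two vertices are within distance two: a rainbow path
-- with three edges would need three distinct colours.
withinTwo : (h : Graph n) → RainbowColorable h 2 → ∀ u v → WithinTwo h u v
withinTwo h (c , _ , connecting) u v with connecting u v
... | [] , _ , _ = same refl
... | (e ∷ []) , _ , _ = adjacent e
... | (_∷_ {v = x} e₁ (e₂ ∷ [])) , _ , _ = via x e₁ e₂
... | (_ ∷ _ ∷ _ ∷ _) , _ , ((c₁≢c₂ ∷ c₁≢c₃ ∷ _) ∷ (c₂≢c₃ ∷ _) ∷ _) =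
  ⊥-elim (noThreeColours _ _ _ c₁≢c₂ c₁≢c₃ c₂≢c₃)

-- rc(h) ≠ 1 implies h misses an edge: if all edges are present, the constant
-- one-colour colouring is rainbow connecting via single edges.
missingEdge : (h : Graph n) → ¬ RainbowColorable h 1 →
  ∃ λ u → ∃ λ v → (¬ u ≡ v) × h u v ≡ false
missingEdge h notOne
  with any? (λ u → any? (λ v → ¬? (u ≟ v) ×-dec (h u v ≟ᵇ false)))
... | yes witness = witness
... | no complete = ⊥-elim (notOne ((λ _ _ → fzero) , (λ _ _ → refl) , connecting))
  where
  connecting : RainbowConnecting h (λ _ _ → fzero)
  connecting u v with u ≟ v
  ... | yes refl = [] , ([] ∷ []) , []
  ... | no u≢v with h u v in uv
  ... | true = (uv ∷ []) , ((u≢v ∷ []) ∷ [] ∷ []) , ([] ∷ [])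
  ... | false = ⊥-elim (complete (u , v , u≢v , uv))

distinctLength : {h : Graph n} {u v : Fin n} → ¬ u ≡ v → (q : Walk h u v) → 1 ≤ len q
distinctLength u≢v [] = ⊥-elim (u≢v refl)
distinctLength u≢v (_ ∷ _) = s≤s z≤n

nonAdjacentLength : {h : Graph n} {u v : Fin n} → ¬ u ≡ v → h u v ≡ false →
  (q : Walk h u v) → 2 ≤ len q
nonAdjacentLength u≢v uv [] = ⊥-elim (u≢v refl)
nonAdjacentLength u≢v uv (e ∷ []) = ⊥-elim (notBoth e uv)
nonAdjacentLength u≢v uv (_ ∷ _ ∷ _) = s≤s (s≤s z≤n)

distanceTwo : {h : Graph n} {u v : Fin n} → ¬ u ≡ v → h u v ≡ false →
  WithinTwo h u v → Dist h u v 2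
distanceTwo u≢v uv (same u≡v) = ⊥-elim (u≢v u≡v)
distanceTwo u≢v uv (adjacent e) = ⊥-elim (notBoth e uv)
distanceTwo u≢v uv (via x e₁ e₂) = ((e₁ ∷ e₂ ∷ []) , refl) , nonAdjacentLength u≢v uv

distanceAtMostTwo : {h : Graph n} (u v : Fin n) → WithinTwo h u v →
  ∃ λ d → Dist h u v d × d ≤ 2
distanceAtMostTwo {h = h} u v near with u ≟ v
... | yes refl = 0 , (([] , refl) , (λ _ → z≤n)) , z≤n
... | no u≢v with h u v in uv
... | true = 1 , (((uv ∷ []) , refl) , distinctLength u≢v) , s≤s z≤n
... | false = 2 , distanceTwo u≢v uv near , ≤-refl

diameterTwo : (h : Graph n) → RainbowColorable h 2 → ¬ RainbowColorable h 1 → Diam h 2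
diameterTwo h two notOne with missingEdge h notOne
... | u , v , u≢v , uv =
  (λ a b → distanceAtMostTwo a b (withinTwo h two a b)) ,
  u , v , distanceTwo u≢v uv (withinTwo h two u v)

N₁⇒adjacent : {h : Graph n} {v u : Fin n} → InN1 h v u → h v u ≡ true
N₁⇒adjacent (((e ∷ []) , _) , _) = e

complementLoopless : (g : Graph n) → ∀ v → complement g v v ≡ false
complementLoopless g v with v ≟ v
... | yes _ = refl
... | no v≢v = ⊥-elim (v≢v refl)

complementSymmetric : (g : Graph n) → IsSimple g → ∀ u v → complement g u v ≡ complement g v u
complementSymmetric g (symmetric , _) u v with u ≟ v | v ≟ u
... | yes _ | yes _ = refl
... | yes u≡v | no v≢u = ⊥-elim (v≢u (sym u≡v))
... | no u≢v | yes v≡u = ⊥-elim (u≢v (sym v≡u))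
... | no _ | no _ = cong not (symmetric u v)

edge⇒complementNonEdge : (g : Graph n) → ∀ u v → g u v ≡ true → complement g u v ≡ false
edge⇒complementNonEdge g u v e with u ≟ v
... | yes _ = refl
... | no _ rewrite e = refl

complementEdge⇒nonEdge : (g : Graph n) → ∀ u v → complement g u v ≡ true → g u v ≡ false
complementEdge⇒nonEdge g u v e with u ≟ v | g u v
... | no _ | false = refl
complementEdge⇒nonEdge g u v () | yes _ | _
complementEdge⇒nonEdge g u v () | no _ | true

total : (Fin n → ℕ) → ℕ
total f = sum (tabulate f)

edgeCount : Graph n → Fin n → Fin n → ℕ
edgeCount h v w = if h v w then 1 else 0

deg≡total : (h : Graph n) (v : Fin n) → deg h v ≡ total (edgeCount h v)
deg≡total h v = cong sum (map-tabulate id (edgeCount h v))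

total-cong : {f f′ : Fin n → ℕ} → (∀ i → f i ≡ f′ i) → total f ≡ total f′
total-cong f≗f′ = cong sum (tabulate-cong f≗f′)

total-+ : (f f′ : Fin n → ℕ) → total (λ i → f i + f′ i) ≡ total f + total f′
total-+ {zero} f f′ = refl
total-+ {suc n} f f′ = begin
  f fzero + f′ fzero + total (λ i → f (fsuc i) + f′ (fsuc i))
    ≡⟨ cong (f fzero + f′ fzero +_) (total-+ (λ i → f (fsuc i)) (λ i → f′ (fsuc i))) ⟩
  f fzero + f′ fzero + (total (λ i → f (fsuc i)) + total (λ i → f′ (fsuc i)))
    ≡⟨ interchange (f fzero) (f′ fzero) _ _ ⟩
  total f + total f′ ∎
  where open ≡-Reasoning

total-single : (f : Fin n → ℕ) (a : Fin n) → f a ≤ total f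
total-single f fzero = m≤m+n _ _
total-single f (fsuc a) = ≤-trans (total-single (λ i → f (fsuc i)) a) (m≤n+m _ (f fzero))

total-pair : (f : Fin n → ℕ) (a b : Fin n) → ¬ a ≡ b → f a + f b ≤ total f
total-pair f fzero fzero a≢b = ⊥-elim (a≢b refl)
total-pair f fzero (fsuc b) _ = +-monoʳ-≤ (f fzero) (total-single (λ i → f (fsuc i)) b)
total-pair f (fsuc a) fzero _ = subst (_≤ total f) (+-comm (f fzero) (f (fsuc a)))
  (+-monoʳ-≤ (f fzero) (total-single (λ i → f (fsuc i)) a))
total-pair f (fsuc a) (fsuc b) a≢b =
  ≤-trans (total-pair (λ i → f (fsuc i)) a b (λ a≡b → a≢b (cong fsuc a≡b))) (m≤n+m _ (f fzero))

others : Fin n → Fin n → ℕ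
others v w = if does (v ≟ w) then 0 else 1

total-ones : ∀ n → total {n} (λ _ → 1) ≡ n
total-ones zero = refl
total-ones (suc n) = cong suc (total-ones n)

total-others : (v : Fin n) → total (others v) ≡ n ∸ 1
total-others {suc n} fzero = total-ones n
total-others {suc (suc n)} (fsuc v) = cong suc (trans (total-cong shift) (total-others v))
  where
  shift : ∀ i → others (fsuc v) (fsuc i) ≡ others v i
  shift i with v ≟ i
  ... | yes _ = refl
  ... | no _ = refl

edgeCount-complement : (g : Graph n) → IsSimple g → ∀ v w →
  edgeCount g v w + edgeCount (complement g) v w ≡ others v w
edgeCount-complement g (_ , loopless) v w with v ≟ w
... | yes refl rewrite loopless v = refl
... | no _ with g v w
... | true = refl
... | false = refl

degreeSum : (g : Graph n) → IsSimple g → ∀ v → deg g v + deg (complement g) v ≡ n ∸ 1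
degreeSum {n} g simple v = begin
  deg g v + deg (complement g) v
    ≡⟨ cong₂ _+_ (deg≡total g v) (deg≡total (complement g) v) ⟩
  total (edgeCount g v) + total (edgeCount (complement g) v)
    ≡⟨ sym (total-+ (edgeCount g v) (edgeCount (complement g) v)) ⟩
  total (λ w → edgeCount g v w + edgeCount (complement g) v w)
    ≡⟨ total-cong (edgeCount-complement g simple v) ⟩
  total (others v)
    ≡⟨ total-others v ⟩
  n ∸ 1 ∎
  where open ≡-Reasoning

twoNeighbours⇒deg≥2 : (h : Graph n) (v a b : Fin n) → ¬ a ≡ b →
  h v a ≡ true → h v b ≡ true → 2 ≤ deg h v
twoNeighbours⇒deg≥2 h v a b a≢b va vb =
  subst₂ (λ x y → x + y ≤ deg h v) (cong count va) (cong count vb)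
    (subst (edgeCount h v a + edgeCount h v b ≤_) (sym (deg≡total h v))
      (total-pair (edgeCount h v) a b a≢b))
  where
  count : Bool → ℕ
  count t = if t then 1 else 0

minimiser : (f : Fin n → ℕ) → Fin n → ∃ λ v → ∀ w → f v ≤ f w
minimiser f v₀ = argmin f v₀ (allFin _) , λ w → lookup (f[argmin]≤f[xs] v₀ (allFin _)) (∈-allFin w)

maximiser : (f : Fin n → ℕ) → Fin n → ∃ λ v → ∀ w → f w ≤ f v
maximiser f v₀ = argmax f v₀ (allFin _) , λ w → lookup (f[xs]≤f[argmax] v₀ (allFin _)) (∈-allFin w)

degreeBounds : (h k : Graph n) → (∀ v → 2 ≤ deg h v) → (∀ v → 2 ≤ deg k v) →
  (∀ v → deg h v + deg k v ≡ n ∸ 1) → Fin n →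
  ∃[ δ ] ∃[ Δ ] (MinDeg h δ × MaxDeg h Δ × 2 ≤ δ × δ ≤ Δ × Δ ≤ n ∸ 3)
degreeBounds {n} h k h≥2 k≥2 sum≡ v₀
  with minimiser (deg h) v₀ | maximiser (deg h) v₀
... | a , a-min | b , b-max =
  deg h a , deg h b , ((a , refl) , a-min) , ((b , refl) , b-max) ,
  h≥2 a , a-min b , subst (deg h b ≤_) (∸-+-assoc n 1 2) (m+n≤o⇒m≤o∸n (deg h b) Δ+2≤n-1)
  where
  Δ+2≤n-1 : deg h b + 2 ≤ n ∸ 1
  Δ+2≤n-1 = subst (deg h b + 2 ≤_) (sum≡ b) (+-monoʳ-≤ (deg h b) (k≥2 b))

module TwoNeighbours
  (h k : Graph n)
  (h-symmetric : ∀ u v → h u v ≡ h v u)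
  (h-loopless : ∀ v → h v v ≡ false)
  (k-loopless : ∀ v → k v v ≡ false)
  (disjoint : ∀ u v → h u v ≡ true → k u v ≡ false)
  (h-near : ∀ u v → WithinTwo h u v)
  (k-near : ∀ u v → WithinTwo k u v)
  where

  -- As wv is an h-edge, w reaches v in k
  -- through some z with kwz, kzv.  Now z ≠ v (k loopless), z is not an
  -- h-neighbour of v (it would be w, but k is loopless), so the h-path of length
  -- two from v to z runs through w, making wz an edge of both h and k.
  noUniqueNeighbour : ∀ v w → h v w ≡ true → (∀ b → h v b ≡ true → b ≡ w) → ⊥
  noUniqueNeighbour v w vw unique with k-near w v
  ... | same w≡v = notBoth (subst (λ t → h v t ≡ true) w≡v vw) (h-loopless v)
  ... | adjacent kwv = notBoth kwv (disjoint w v (trans (h-symmetric w v) vw))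
  ... | via z kwz kzv = notBoth kwz (disjoint w z hwz)
    where
    hwz : h w z ≡ true
    hwz with h-near v z
    ... | same v≡z = ⊥-elim (notBoth (subst (λ t → k t v ≡ true) (sym v≡z) kzv) (k-loopless v))
    ... | adjacent vz = ⊥-elim (notBoth (subst (λ t → k w t ≡ true) (unique z vz) kwz) (k-loopless w))
    ... | via y vy yz = subst (λ t → h t z ≡ true) (unique y vy) yz

  twoNeighbours : (v : Fin n) → (∃ λ x → ¬ x ≡ v) →
    ∃ λ a → ∃ λ b → (¬ a ≡ b) × h v a ≡ true × h v b ≡ true
  twoNeighbours v (x , x≢v) = second firstNeighbour
    where
    firstNeighbour : ∃ λ w → h v w ≡ true
    firstNeighbour with h-near v x
    ... | same v≡x = ⊥-elim (x≢v (sym v≡x))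
    ... | adjacent vx = x , vx
    ... | via y vy _ = y , vy

    second : (∃ λ w → h v w ≡ true) → ∃ λ a → ∃ λ b → (¬ a ≡ b) × h v a ≡ true × h v b ≡ true
    second (w , vw) with any? (λ b → ¬? (b ≟ w) ×-dec (h v b ≟ᵇ true))
    ... | yes (b , b≢w , vb) = b , w , b≢w , vb , vw
    ... | no none = ⊥-elim (noUniqueNeighbour v w vw unique)
      where
      unique : ∀ b → h v b ≡ true → b ≡ w
      unique b vb with b ≟ w
      ... | yes b≡w = b≡w
      ... | no b≢w = ⊥-elim (none (b , b≢w , vb))

  deg≥2 : (v : Fin n) → (∃ λ x → ¬ x ≡ v) → 2 ≤ deg h v
  deg≥2 v other with twoNeighbours v other
  ... | a , b , a≢b , va , vb = twoNeighbours⇒deg≥2 h v a b a≢b va vb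

otherVertex : (a b : Fin n) → ¬ a ≡ b → (v : Fin n) → ∃ λ x → ¬ x ≡ v
otherVertex a b a≢b v with a ≟ v
... | no a≢v = a , a≢v
... | yes refl = b , λ b≡a → a≢b (sym b≡a)

-- If g and Ḡ have all pairs within distance two, no neighbour u of v is adjacent
-- to all of N₂(v): the Ḡ-path u x v gives x ∈ N₂(v) with x not adjacent to u.
notAdjacentToAllOfN₂ : (g : Graph n) → IsSimple g →
  (∀ u v → WithinTwo g u v) → (∀ u v → WithinTwo (complement g) u v) →
  ∀ (v u : Fin n) → InN1 g v u → ¬ (∀ (w : Fin n) → InN2 g v w → g u w ≡ true)
notAdjacentToAllOfN₂ g (symmetric , loopless) g-near ḡ-near v u N₁ adjacentToN₂
  with ḡ-near u v
... | same refl = notBoth (N₁⇒adjacent N₁) (loopless v)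
... | adjacent ḡuv = notBoth (trans (symmetric u v) (N₁⇒adjacent N₁)) (complementEdge⇒nonEdge g u v ḡuv)
... | via x ḡux ḡxv = notBoth (adjacentToN₂ x x∈N₂) (complementEdge⇒nonEdge g u x ḡux)
  where
  v≢x : ¬ v ≡ x
  v≢x refl = notBoth ḡxv (complementLoopless g v)
  x∈N₂ : InN2 g v x
  x∈N₂ = distanceTwo v≢x (trans (symmetric v x) (complementEdge⇒nonEdge g x v ḡxv)) (g-near v x)

proposition1 : (n : ℕ) (g : Graph n) → IsSimple g
    → Connected g → Connected (complement g)
    → RC g 2 → RC (complement g) 2
    → (Diam g 2 × Diam (complement g) 2)
    × ((∃[ δ ] ∃[ Δ ] (MinDeg g δ × MaxDeg g Δ × 2 ≤ δ × δ ≤ Δ × Δ ≤ n ∸ 3))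
    × (∃[ δ ] ∃[ Δ ] (MinDeg (complement g) δ × MaxDeg (complement g) Δ × 2 ≤ δ × δ ≤ Δ × Δ ≤ n ∸ 3)))
    × (∀ (v u : Fin n) → InN1 g v u → ¬ (∀ (w : Fin n) → InN2 g v w → g u w ≡ true))
proposition1 n g simple@(symmetric , loopless) _ _ (g-two , g-min) (ḡ-two , ḡ-min) =
  (diameterTwo g g-two g-notOne , diameterTwo ḡ ḡ-two ḡ-notOne) ,
  (degreeBounds g ḡ g≥2 ḡ≥2 (degreeSum g simple) someVertex ,
   degreeBounds ḡ g ḡ≥2 g≥2 (λ v → trans (+-comm (deg ḡ v) (deg g v)) (degreeSum g simple v)) someVertex) ,
  notAdjacentToAllOfN₂ g simple g-near ḡ-near
  where
  ḡ : Graph n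
  ḡ = complement g

  g-notOne : ¬ RainbowColorable g 1
  g-notOne = g-min 1 (s≤s (s≤s z≤n))
  ḡ-notOne : ¬ RainbowColorable ḡ 1
  ḡ-notOne = ḡ-min 1 (s≤s (s≤s z≤n))

  g-near : ∀ u v → WithinTwo g u v
  g-near = withinTwo g g-two
  ḡ-near : ∀ u v → WithinTwo ḡ u v
  ḡ-near = withinTwo ḡ ḡ-two

  someVertex : Fin n
  someVertex = proj₁ (missingEdge g g-notOne)

  -- the missing edge of g shows that there are at least two vertices
  other : (v : Fin n) → ∃ λ x → ¬ x ≡ v
  other with missingEdge g g-notOne
  ... | a , b , a≢b , _ = otherVertex a b a≢b

  g≥2 : ∀ v → 2 ≤ deg g v
  g≥2 v = TwoNeighbours.deg≥2 g ḡ symmetric loopless (complementLoopless g)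
    (edge⇒complementNonEdge g) g-near ḡ-near v (other v)
  ḡ≥2 : ∀ v → 2 ≤ deg ḡ v
  ḡ≥2 v = TwoNeighbours.deg≥2 ḡ g (complementSymmetric g simple) (complementLoopless g) loopless
    (complementEdge⇒nonEdge g) ḡ-near g-near v (other v)
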